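{- For every positive integer $k$: $\gamma_k(P_{3k})=1$, $\gamma_{k+1}(P_{3k+1})=\binom{k+2}{2}+k$, and $\gamma_{k+1}(P_{3k+2})=k+2$.
   Context: For a simple graph $G$, a set $D$ of vertices is dominating if every vertex not in $D$ is adjacent to some vertex of $D$; $\gamma_k(G)$ is the number of dominating sets of $G$ of cardinality exactly $k$. $P_n$ is the path with $n$ vertices. -}

module Defs where

open import Data.Nat using (ℕ; zero; suc; _+_)
open import Data.Fin using (Fin; toℕ)
open import Data.Fin.Subset using (Subset; _∈_; ∣_∣)
open import Data.Fin.Subset.Properties using (_∈?_)
open import Data.Bool using (Bool; true; false)
open import Data.List using (List; []; _∷_; map; _++_; filter; length)
open import Data.Vec using (_∷_; [])
open import Data.Product using (Σ; ∃; _×_; _,_)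
open import Data.Sum using (_⊎_)
open import Data.Fin.Properties using (any?; all?)
open import Relation.Nullary using (Dec; yes; no; ¬_)
open import Relation.Nullary.Decidable using (_⊎-dec_; _×-dec_)
import Data.Nat.Properties as ℕP
open import Relation.Binary.PropositionalEquality using (_≡_)

PathAdj : (n : ℕ) → Fin n → Fin n → Set
PathAdj n i j = (suc (toℕ i) ≡ toℕ j) ⊎ (suc (toℕ j) ≡ toℕ i)

pathAdj? : (n : ℕ) → (i j : Fin n) → Dec (PathAdj n i j)
pathAdj? n i j = (suc (toℕ i) ℕP.≟ toℕ j) ⊎-dec (suc (toℕ j) ℕP.≟ toℕ i)

DominatingPath : (n : ℕ) → Subset n → Set
DominatingPath n D = ∀ (v : Fin n) → ¬ (v ∈ D) → ∃ λ u → (u ∈ D) × PathAdj n u v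

dominatingPath? : (n : ℕ) → (D : Subset n) → Dec (DominatingPath n D)
dominatingPath? n D = all? λ v → dec v
  where
  dec : (v : Fin n) → Dec (¬ (v ∈ D) → ∃ λ u → (u ∈ D) × PathAdj n u v)
  dec v with v ∈? D
  ... | yes v∈D = yes (λ v∉D → Relation.Nullary.contradiction v∈D v∉D)
    where import Relation.Nullary
  ... | no v∉D with any? (λ u → (u ∈? D) ×-dec pathAdj? n u v)
  ...   | yes p = yes (λ _ → p)
  ...   | no ¬p = no (λ f → ¬p (f v∉D))

allSubsets : (n : ℕ) → List (Subset n)
allSubsets zero = [] ∷ []
allSubsets (suc n) = map (true ∷_) (allSubsets n) ++ map (false ∷_) (allSubsets n)

γ-path : (k n : ℕ) → ℕ
γ-path k n = length (filter (λ D → (∣ D ∣ ℕP.≟ k) ×-dec dominatingPath? n D) (allSubsets n))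

-- Scanning a path from the left, whether a set of vertices is dominating depends only
-- on the state of the last vertex read: chosen, dominated but not chosen, or not yet
-- dominated (then the next vertex must be chosen). So the numbers γ-after s k n of
-- k-subsets of P_n compatible with each state obey a three-state transfer recurrence.
-- In particular c k n = γ-after chosen k n satisfies
-- c (k+1) (n+3) = c k (n+2) + c k (n+1) + c k n and vanishes for n ≥ 3k+2, whence by
-- induction on k: c k (3k+1) = 1, c k (3k) = k+1 and c (k+1) (3k+2) = C(k+2,2) + k+1.
-- Finally γ_(k+1)(P_(n+2)) = c k (n+1) + c k n.
module Submission where

open import Defs
open import Data.Nat using (ℕ; zero; suc; _+_; _*_; _≥_; _≤_; s≤s)
open import Data.Nat.Combinatorics using (_C_; nCk+nC[k+1]≡[n+1]C[k+1]; nC1≡n)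
import Data.Nat.Properties as ℕ
open import Data.Bool using (Bool; true; false; _∧_; _∨_; T)
open import Data.Bool.Properties using (T-∧; T-∨)
open import Data.Unit using (tt)
open import Data.Empty using (⊥-elim)
open import Data.Fin using (Fin; toℕ; zero; suc)
open import Data.Fin.Subset using (Subset; _∈_; _∉_; ∣_∣)
open import Data.Vec using ([]; _∷_; here; there)
open import Data.List using (List; []; _∷_; map; _++_; filter; length)
open import Data.List.Properties using (filter-++; filter-none; filter-≐; length-++)
import Data.List.Relation.Unary.All as All
open import Data.Product using (_×_; _,_; ∃; map₂)
open import Data.Product.Function.NonDependent.Propositional using (_×-⇔_)
open import Data.Sum using (_⊎_; inj₁; inj₂)
open import Function using (_∘_)
open import Function.Bundles using (_⇔_; mk⇔; Equivalence)
import Function.Properties.Equivalence as ⇔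
open import Relation.Nullary using (does; ¬_)
open import Relation.Nullary.Decidable using (_×-dec_; T?)
open import Level using (0ℓ)
open import Relation.Unary using (Pred; Decidable; _≐_)
open import Relation.Binary.PropositionalEquality using (_≡_; refl; sym; trans; cong; cong₂; subst; module ≡-Reasoning)

private variable
  n : ℕ

HasNeighbourIn : Subset n → Fin n → Set
HasNeighbourIn {n} D v = ∃ λ u → u ∈ D × PathAdj n u v

CoveredAfter : Bool → Subset n → Fin n → Set
CoveredAfter p D v = (toℕ v ≡ 0 × T p) ⊎ HasNeighbourIn D v

-- D dominates the path extended on the left by one extra vertex, chosen iff p;
-- the extra vertex itself need not be dominated.
DominatingAfter : Bool → Subset n → Set
DominatingAfter p D = ∀ v → v ∉ D → CoveredAfter p D v

firstIn : Subset n → Bool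
firstIn []      = false
firstIn (x ∷ _) = x

dominatingAfter : Bool → Subset n → Bool
dominatingAfter p []      = true
dominatingAfter p (x ∷ D) = (x ∨ p ∨ firstIn D) ∧ dominatingAfter x D

pathAdj-suc⁺ : {u v : Fin n} → PathAdj n u v → PathAdj (suc n) (suc u) (suc v)
pathAdj-suc⁺ (inj₁ e) = inj₁ (cong suc e)
pathAdj-suc⁺ (inj₂ e) = inj₂ (cong suc e)

pathAdj-suc⁻ : {u v : Fin n} → PathAdj (suc n) (suc u) (suc v) → PathAdj n u v
pathAdj-suc⁻ (inj₁ e) = inj₁ (ℕ.suc-injective e)
pathAdj-suc⁻ (inj₂ e) = inj₂ (ℕ.suc-injective e)

hasNeighbour-zero⁻ : ∀ x (D : Subset n) → HasNeighbourIn (x ∷ D) zero → T (firstIn D)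
hasNeighbour-zero⁻ x D (zero         , _          , inj₁ ())
hasNeighbour-zero⁻ x D (zero         , _          , inj₂ ())
hasNeighbour-zero⁻ x D (suc zero     , there here , _)       = tt
hasNeighbour-zero⁻ x D (suc (suc _)  , _          , inj₁ ())
hasNeighbour-zero⁻ x D (suc (suc _)  , _          , inj₂ ())

hasNeighbour-zero⁺ : ∀ x (D : Subset n) → T (firstIn D) → HasNeighbourIn (x ∷ D) zero
hasNeighbour-zero⁺ x (true ∷ D) _ = suc zero , there here , inj₂ refl

hasNeighbour-suc⁻ : ∀ x (D : Subset n) v → HasNeighbourIn (x ∷ D) (suc v) → CoveredAfter x D v
hasNeighbour-suc⁻ x D v (zero  , here     , inj₁ e) = inj₁ (sym (ℕ.suc-injective e) , tt)
hasNeighbour-suc⁻ x D v (suc u , there u∈ , adj)    = inj₂ (u , u∈ , pathAdj-suc⁻ adj)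

hasNeighbour-suc⁺ : ∀ x (D : Subset n) v → CoveredAfter x D v → HasNeighbourIn (x ∷ D) (suc v)
hasNeighbour-suc⁺ true D v (inj₁ (v≡0 , _))    = zero , here , inj₁ (cong suc (sym v≡0))
hasNeighbour-suc⁺ x    D v (inj₂ (u , u∈ , adj)) = suc u , there u∈ , pathAdj-suc⁺ adj

dominatingAfter-cons⁻ : ∀ p x (D : Subset n) → DominatingAfter p (x ∷ D) →
                        T (x ∨ p ∨ firstIn D) × DominatingAfter x D
dominatingAfter-cons⁻ p x D dom = firstCovered x dom , restCovered
  where
  firstCovered : ∀ x → DominatingAfter p (x ∷ D) → T (x ∨ p ∨ firstIn D)
  firstCovered true  _   = tt
  firstCovered false dom with dom zero (λ ())
  ... | inj₁ (_ , p-chosen) = Equivalence.from T-∨ (inj₁ p-chosen)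
  ... | inj₂ neighbour      = Equivalence.from T-∨ (inj₂ (hasNeighbour-zero⁻ false D neighbour))
  restCovered : DominatingAfter x D
  restCovered v v∉D with dom (suc v) (λ { (there v∈D) → v∉D v∈D })
  ... | inj₂ neighbour = hasNeighbour-suc⁻ x D v neighbour

dominatingAfter-cons⁺ : ∀ p x (D : Subset n) → T (x ∨ p ∨ firstIn D) → DominatingAfter x D →
                        DominatingAfter p (x ∷ D)
dominatingAfter-cons⁺ p true  D _     _   zero    zero∉ = ⊥-elim (zero∉ here)
dominatingAfter-cons⁺ p false D first _   zero    _ with Equivalence.to T-∨ first
... | inj₁ p-chosen     = inj₁ (refl , p-chosen)
... | inj₂ next-chosen  = inj₂ (hasNeighbour-zero⁺ false D next-chosen)
dominatingAfter-cons⁺ p x     D _     dom (suc v) v∉    =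
  inj₂ (hasNeighbour-suc⁺ x D v (dom v (λ v∈D → v∉ (there v∈D))))

T-dominatingAfter : ∀ p (D : Subset n) → T (dominatingAfter p D) ⇔ DominatingAfter p D
T-dominatingAfter p []      = mk⇔ (λ _ ()) (λ _ → tt)
T-dominatingAfter p (x ∷ D) =
  ⇔.trans T-∧ (⇔.trans (⇔.refl ×-⇔ T-dominatingAfter x D)
    (mk⇔ (λ (first , rest) → dominatingAfter-cons⁺ p x D first rest) (dominatingAfter-cons⁻ p x D)))

dominatingPath⇔dominatingAfter : (D : Subset n) → DominatingPath n D ⇔ T (dominatingAfter false D)
dominatingPath⇔dominatingAfter D = ⇔.trans (mk⇔ to from) (⇔.sym (T-dominatingAfter false D))
  where
  to : DominatingPath _ D → DominatingAfter false D
  to dom v v∉D = inj₂ (dom v v∉D)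
  from : DominatingAfter false D → DominatingPath _ D
  from dom v v∉D with dom v v∉D
  ... | inj₂ neighbour = neighbour

countSubsets : {P : Pred (Subset n) 0ℓ} → Decidable P → ℕ
countSubsets {n} P? = length (filter P? (allSubsets n))

length-filter-map : ∀ {A B : Set} {P : Pred B 0ℓ} (P? : Decidable P) (f : A → B) (xs : List A) →
                    length (filter P? (map f xs)) ≡ length (filter (P? ∘ f) xs)
length-filter-map P? f []       = refl
length-filter-map P? f (x ∷ xs) with does (P? (f x))
... | true  = cong suc (length-filter-map P? f xs)
... | false = length-filter-map P? f xs

countSubsets-suc : {P : Pred (Subset (suc n)) 0ℓ} (P? : Decidable P) →
                   countSubsets P? ≡ countSubsets (P? ∘ (true ∷_)) + countSubsets (P? ∘ (false ∷_))
countSubsets-suc {n} P? = begin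
  length (filter P? (map (true ∷_) S ++ map (false ∷_) S))
    ≡⟨ cong length (filter-++ P? (map (true ∷_) S) (map (false ∷_) S)) ⟩
  length (filter P? (map (true ∷_) S) ++ filter P? (map (false ∷_) S))
    ≡⟨ length-++ (filter P? (map (true ∷_) S)) ⟩
  length (filter P? (map (true ∷_) S)) + length (filter P? (map (false ∷_) S))
    ≡⟨ cong₂ _+_ (length-filter-map P? (true ∷_) S) (length-filter-map P? (false ∷_) S) ⟩
  countSubsets (P? ∘ (true ∷_)) + countSubsets (P? ∘ (false ∷_)) ∎
  where
  open ≡-Reasoning
  S = allSubsets n

countSubsets-cong : {P Q : Pred (Subset n) 0ℓ} (P? : Decidable P) (Q? : Decidable Q) →
                    P ≐ Q → countSubsets P? ≡ countSubsets Q?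
countSubsets-cong {n} P? Q? P≐Q = cong length (filter-≐ P? Q? P≐Q (allSubsets n))

countSubsets-none : {P : Pred (Subset n) 0ℓ} (P? : Decidable P) → (∀ D → ¬ P D) → countSubsets P? ≡ 0
countSubsets-none {n} P? ¬P = cong length (filter-none P? (All.universal ¬P (allSubsets n)))

data LeftNeighbour : Set where
  chosen dominated undominated : LeftNeighbour

constraint : LeftNeighbour → Subset n → Bool
constraint chosen      D = dominatingAfter true D
constraint dominated   D = dominatingAfter false D
constraint undominated D = dominatingAfter false (false ∷ D)

γ-after : LeftNeighbour → ℕ → ℕ → ℕ
γ-after _           (suc k) zero    = 0
γ-after undominated zero    _       = 0
γ-after _           zero    zero    = 1
γ-after chosen      zero    (suc n) = γ-after dominated zero n
γ-after dominated   zero    (suc n) = γ-after undominated zero n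
γ-after chosen      (suc k) (suc n) = γ-after chosen k n + γ-after dominated (suc k) n
γ-after dominated   (suc k) (suc n) = γ-after chosen k n + γ-after undominated (suc k) n
γ-after undominated (suc k) (suc n) = γ-after chosen k n

sizedConstraint? : ∀ s k → Decidable {A = Subset n} (λ D → ∣ D ∣ ≡ k × T (constraint s D))
sizedConstraint? s k D = (∣ D ∣ ℕ.≟ k) ×-dec T? (constraint s D)

constraint-chosen : ∀ s (D : Subset n) → constraint s (true ∷ D) ≡ constraint chosen D
constraint-chosen chosen      D = refl
constraint-chosen dominated   D = refl
constraint-chosen undominated D = refl

countSubsets-chosenFirst : ∀ s k → countSubsets (sizedConstraint? {suc n} s (suc k) ∘ (true ∷_)) ≡
                                   countSubsets (sizedConstraint? {n} chosen k)
countSubsets-chosenFirst {n} s k = countSubsets-cong {n} _ _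
  ( (λ (size , c) → ℕ.suc-injective size , subst T (constraint-chosen s _) c)
  , (λ (size , c) → cong suc size , subst T (sym (constraint-chosen s _)) c) )

countSubsets-γ-after : ∀ s k n → countSubsets (sizedConstraint? {n} s k) ≡ γ-after s k n
countSubsets-γ-after undominated zero    zero    = refl
countSubsets-γ-after chosen      zero    zero    = refl
countSubsets-γ-after dominated   zero    zero    = refl
countSubsets-γ-after _           (suc k) zero    = refl
countSubsets-γ-after s k (suc n) = trans (countSubsets-suc {n} (sizedConstraint? s k)) (split s k)
  where
  noEmptyFirst : ∀ s → countSubsets (sizedConstraint? {suc n} s zero ∘ (true ∷_)) ≡ 0
  noEmptyFirst s = countSubsets-none {n} _ (λ _ ())
  split : ∀ s k → countSubsets (sizedConstraint? {suc n} s k ∘ (true ∷_)) +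
                  countSubsets (sizedConstraint? {suc n} s k ∘ (false ∷_)) ≡ γ-after s k (suc n)
  split chosen      zero    = cong₂ _+_ (noEmptyFirst chosen) (countSubsets-γ-after dominated zero n)
  split dominated   zero    = cong₂ _+_ (noEmptyFirst dominated) (countSubsets-γ-after undominated zero n)
  split undominated zero    = cong₂ _+_ (noEmptyFirst undominated) (countSubsets-none {n} _ (λ _ ()))
  split chosen      (suc k) = cong₂ _+_
    (trans (countSubsets-chosenFirst {n} chosen k) (countSubsets-γ-after chosen k n))
    (countSubsets-γ-after dominated (suc k) n)
  split dominated   (suc k) = cong₂ _+_
    (trans (countSubsets-chosenFirst {n} dominated k) (countSubsets-γ-after chosen k n))
    (countSubsets-γ-after undominated (suc k) n)
  split undominated (suc k) = trans (cong₂ _+_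
    (trans (countSubsets-chosenFirst {n} undominated k) (countSubsets-γ-after chosen k n))
    (countSubsets-none {n} _ (λ _ ())))
    (ℕ.+-identityʳ _)

γ-path≡γ-after : ∀ k n → γ-path k n ≡ γ-after dominated k n
γ-path≡γ-after k n = trans
  (countSubsets-cong {n} _ (sizedConstraint? dominated k)
    ( map₂ (Equivalence.to (dominatingPath⇔dominatingAfter _))
    , map₂ (Equivalence.from (dominatingPath⇔dominatingAfter _)) ))
  (countSubsets-γ-after dominated k n)

γ-after-*-suc : ∀ s k r m → γ-after s k (r + 3 * suc m) ≡ γ-after s k (r + (3 + 3 * m))
γ-after-*-suc s k r m = cong (λ i → γ-after s k (r + i)) (ℕ.*-suc 3 m)

γ-chosen-vanishes : ∀ m n → 2 + 3 * m ≤ n → γ-after chosen m n ≡ 0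
γ-chosen-vanishes zero    (suc zero)          (s≤s ())
γ-chosen-vanishes zero    (suc (suc n))       _                = refl
γ-chosen-vanishes (suc m) (suc zero)          (s≤s ())
γ-chosen-vanishes (suc m) (suc (suc zero))    (s≤s (s≤s ()))
γ-chosen-vanishes (suc m) (suc (suc (suc n))) le               = begin
  γ-after chosen (suc m) (3 + n)
    ≡⟨⟩
  γ-after chosen m (2 + n) + (γ-after chosen m (1 + n) + γ-after chosen m n)
    ≡⟨ cong₂ _+_ (γ-chosen-vanishes m (2 + n) (ℕ.m≤n⇒m≤1+n (ℕ.m≤n⇒m≤1+n le′)))
         (cong₂ _+_ (γ-chosen-vanishes m (1 + n) (ℕ.m≤n⇒m≤1+n le′)) (γ-chosen-vanishes m n le′)) ⟩
  0 ∎
  where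
  open ≡-Reasoning
  le′ : 2 + 3 * m ≤ n
  le′ = ℕ.+-cancelˡ-≤ 3 _ _ (subst (_≤ 3 + n) (cong (2 +_) (ℕ.*-suc 3 m)) le)

γ-chosen-3m+1 : ∀ m → γ-after chosen m (1 + 3 * m) ≡ 1
γ-chosen-3m+1 zero    = refl
γ-chosen-3m+1 (suc m) = begin
  γ-after chosen (suc m) (1 + 3 * suc m)
    ≡⟨ γ-after-*-suc chosen (suc m) 1 m ⟩
  γ-after chosen m (3 + 3 * m) + (γ-after chosen m (2 + 3 * m) + γ-after chosen m (1 + 3 * m))
    ≡⟨ cong₂ _+_ (γ-chosen-vanishes m _ (ℕ.n≤1+n _))
         (cong₂ _+_ (γ-chosen-vanishes m _ ℕ.≤-refl) (γ-chosen-3m+1 m)) ⟩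
  1 ∎
  where open ≡-Reasoning

γ-chosen-3m : ∀ m → γ-after chosen m (3 * m) ≡ suc m
γ-chosen-3m zero    = refl
γ-chosen-3m (suc m) = begin
  γ-after chosen (suc m) (3 * suc m)
    ≡⟨ γ-after-*-suc chosen (suc m) 0 m ⟩
  γ-after chosen m (2 + 3 * m) + (γ-after chosen m (1 + 3 * m) + γ-after chosen m (3 * m))
    ≡⟨ cong₂ _+_ (γ-chosen-vanishes m _ ℕ.≤-refl) (cong₂ _+_ (γ-chosen-3m+1 m) (γ-chosen-3m m)) ⟩
  2 + m ∎
  where open ≡-Reasoning

C2-suc : ∀ n → suc n C 2 ≡ n + n C 2
C2-suc n = trans (sym (nCk+nC[k+1]≡[n+1]C[k+1] n 1)) (cong (_+ n C 2) (nC1≡n n))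

γ-chosen-3m+2 : ∀ m → γ-after chosen (suc m) (2 + 3 * m) ≡ (2 + m) C 2 + suc m
γ-chosen-3m+2 zero    = refl
γ-chosen-3m+2 (suc m) = begin
  γ-after chosen (2 + m) (2 + 3 * suc m)
    ≡⟨ γ-after-*-suc chosen (2 + m) 2 m ⟩
  γ-after chosen (suc m) (4 + 3 * m) +
    (γ-after chosen (suc m) (3 + 3 * m) + γ-after chosen (suc m) (2 + 3 * m))
    ≡⟨ cong₂ _+_ (trans (sym (γ-after-*-suc chosen (suc m) 1 m)) (γ-chosen-3m+1 (suc m)))
         (cong₂ _+_ (trans (sym (γ-after-*-suc chosen (suc m) 0 m)) (γ-chosen-3m (suc m)))
                    (γ-chosen-3m+2 m)) ⟩
  1 + ((2 + m) + ((2 + m) C 2 + suc m))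
    ≡⟨ cong suc (sym (ℕ.+-assoc (2 + m) ((2 + m) C 2) (suc m))) ⟩
  suc ((2 + m) + (2 + m) C 2 + suc m)
    ≡⟨ sym (ℕ.+-suc ((2 + m) + (2 + m) C 2) (suc m)) ⟩
  (2 + m) + (2 + m) C 2 + (2 + m)
    ≡⟨ cong (_+ (2 + m)) (sym (C2-suc (2 + m))) ⟩
  (3 + m) C 2 + (2 + m) ∎
  where open ≡-Reasoning

γ-dominated-3k : ∀ k → γ-after dominated k (3 * k) ≡ 1
γ-dominated-3k zero    = refl
γ-dominated-3k (suc m) = trans (γ-after-*-suc dominated (suc m) 0 m)
  (cong₂ _+_ (γ-chosen-vanishes m _ ℕ.≤-refl) (γ-chosen-3m+1 m))

γ-dominated-3k+1 : ∀ k → γ-after dominated (suc k) (1 + 3 * k) ≡ (2 + k) C 2 + k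
γ-dominated-3k+1 zero    = refl
γ-dominated-3k+1 (suc m) = begin
  γ-after dominated (2 + m) (1 + 3 * suc m)
    ≡⟨ γ-after-*-suc dominated (2 + m) 1 m ⟩
  γ-after chosen (suc m) (3 + 3 * m) + γ-after chosen (suc m) (2 + 3 * m)
    ≡⟨ cong₂ _+_ (trans (sym (γ-after-*-suc chosen (suc m) 0 m)) (γ-chosen-3m (suc m)))
                 (γ-chosen-3m+2 m) ⟩
  (2 + m) + ((2 + m) C 2 + suc m)
    ≡⟨ sym (ℕ.+-assoc (2 + m) ((2 + m) C 2) (suc m)) ⟩
  (2 + m) + (2 + m) C 2 + suc m
    ≡⟨ cong (_+ suc m) (sym (C2-suc (2 + m))) ⟩
  (3 + m) C 2 + suc m ∎
  where open ≡-Reasoning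

γ-dominated-3k+2 : ∀ k → γ-after dominated (suc k) (2 + 3 * k) ≡ 2 + k
γ-dominated-3k+2 k = cong₂ _+_ (γ-chosen-3m+1 k) (γ-chosen-3m k)

mainTheorem7 : (k : ℕ) → k ≥ 1 →
    (γ-path k (3 * k) ≡ 1)
    × (γ-path (k + 1) (3 * k + 1) ≡ ((k + 2) C 2) + k)
    × (γ-path (k + 1) (3 * k + 2) ≡ k + 2)
mainTheorem7 k _ =
  trans (γ-path≡γ-after k (3 * k)) (γ-dominated-3k k) ,
  (begin
    γ-path (k + 1) (3 * k + 1)               ≡⟨ cong₂ γ-path (ℕ.+-comm k 1) (ℕ.+-comm (3 * k) 1) ⟩
    γ-path (suc k) (1 + 3 * k)               ≡⟨ γ-path≡γ-after (suc k) (1 + 3 * k) ⟩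
    γ-after dominated (suc k) (1 + 3 * k)    ≡⟨ γ-dominated-3k+1 k ⟩
    (2 + k) C 2 + k                          ≡⟨ cong (λ i → i C 2 + k) (ℕ.+-comm 2 k) ⟩
    (k + 2) C 2 + k                          ∎) ,
  (begin
    γ-path (k + 1) (3 * k + 2)               ≡⟨ cong₂ γ-path (ℕ.+-comm k 1) (ℕ.+-comm (3 * k) 2) ⟩
    γ-path (suc k) (2 + 3 * k)               ≡⟨ γ-path≡γ-after (suc k) (2 + 3 * k) ⟩
    γ-after dominated (suc k) (2 + 3 * k)    ≡⟨ γ-dominated-3k+2 k ⟩
    2 + k                                    ≡⟨ ℕ.+-comm 2 k ⟩
    k + 2                                    ∎)
  where open ≡-Reasoning
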